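{- Let $r,s,t,m$ be positive integers. Let $G$ be an $n$-vertex graph with no copy of $K_r$ as a subgraph and no copy of $K_{s,t}$ as an induced subgraph. If $t_m(G)$ is the number of cliques of order $m$ in $G$, then \[ m\cdot t_m(G) \leq 2(t+r)^{tm/s}(r+s)^s n^{m-\frac{m-1}{s}} + (r+s)^s n^{m-1}. \]
   Context: A clique of order $m$ is a set of $m$ pairwise adjacent vertices. $K_{s,t}$ is the complete bipartite graph with parts of sizes $s$ and $t$. -}

module Defs where

open import Data.Nat using (ℕ; zero; suc; _+_; _*_; _∸_; _^_; _≡ᵇ_)
open import Data.Bool using (Bool; true; false; T; _∧_; _∨_; not)
open import Data.Fin using (Fin; _≟_)
open import Data.Fin.Subset using (Subset; inside; outside; ∣_∣)
open import Data.Vec using (Vec; []; _∷_; lookup)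
open import Data.List using (List; []; _∷_; [_]; map; _++_; filterᵇ; length; allFin)
open import Relation.Nullary.Decidable using (⌊_⌋)
open import Relation.Binary.PropositionalEquality using (_≡_; _≢_)
open import Function.Definitions using (Injective)
open import Data.Product using (Σ; _×_; ∃₂)

record Graph (n : ℕ) : Set where
  field
    adj    : Fin n → Fin n → Bool
    sym    : ∀ i j → adj i j ≡ adj j i
    irrefl : ∀ i → adj i i ≡ false

open Graph public

Adj : ∀ {n} → Graph n → Fin n → Fin n → Set
Adj G i j = T (adj G i j)

HasKr : ∀ {n} → ℕ → Graph n → Set
HasKr {n} r G = Σ (Fin r → Fin n) λ f →
  Injective _≡_ _≡_ f × (∀ i j → i ≢ j → Adj G (f i) (f j))

HasInducedKst : ∀ {n} → ℕ → ℕ → Graph n → Set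
HasInducedKst {n} s t G = ∃₂ λ (f : Fin s → Fin n) (g : Fin t → Fin n) →
  Injective _≡_ _≡_ f × Injective _≡_ _≡_ g ×
  (∀ i j → f i ≢ g j) ×
  (∀ i j → Adj G (f i) (g j)) ×
  (∀ i i' → i ≢ i' → ¬A (Adj G (f i) (f i'))) ×
  (∀ j j' → j ≢ j' → ¬A (Adj G (g j) (g j')))
  where
  open import Relation.Nullary using () renaming (¬_ to ¬A)

allᵇ : ∀ {A : Set} → (A → Bool) → List A → Bool
allᵇ p []       = true
allᵇ p (x ∷ xs) = p x ∧ allᵇ p xs

allSubsets : (n : ℕ) → List (Subset n)
allSubsets zero    = [ [] ]
allSubsets (suc n) = map (outside ∷_) (allSubsets n) ++ map (inside ∷_) (allSubsets n)

isCliqueᵇ : ∀ {n} → Graph n → Subset n → Bool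
isCliqueᵇ {n} G S =
  allᵇ (λ i → allᵇ (λ j → not (lookup S i ∧ lookup S j ∧ not ⌊ i ≟ j ⌋) ∨ adj G i j)
                 (allFin n))
      (allFin n)

cliqueCount : ∀ {n} → Graph n → ℕ → ℕ
cliqueCount {n} G m =
  length (filterᵇ (λ S → isCliqueᵇ G S ∧ (∣ S ∣ ≡ᵇ m)) (allSubsets n))

-- Let N(Q) be the common neighbourhood of an (m − 1)-clique Q. Counting pairs (Q, v) with
-- v ∈ N(Q) gives m · t_m ≤ ∑_Q |N(Q)|. Each N(Q) is K_r-free, and a supersaturation lemma
-- (induction on r and s: either some vertex has a dense neighbourhood, which is K_{r−1}-free,
-- or every vertex has many non-neighbours) shows that a K_r-free set of size d contains at
-- least (d − r^s)^s / r^{s²} ordered independent s-tuples. The same lemma bounds the common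
-- neighbourhood of an independent s-tuple y by r^t vertices, since an independent t-tuple
-- inside it would complete an induced K_{s,t}; hence y lies in N(Q) for at most r^{t(m−1)}
-- cliques Q. Comparing the two counts of pairs (Q, y) through the power mean inequality
-- (∑_Q a_Q)^s ≤ t_{m−1}^{s−1} ∑_Q a_Q^s, with t_{m−1} ≤ n^{m−1}, gives the bound.

module Submission where

open import Defs hiding (sym)
open import Data.Nat using (ℕ; zero; suc; _+_; _*_; _∸_; _^_; _≤_; _<_; z≤n; s≤s; _≡ᵇ_; NonZero; >-nonZero; >-nonZero⁻¹)
open import Data.Nat.Properties hiding (_≟_)
open import Data.Nat.Solver using (module +-*-Solver)
open import Algebra.Properties.CommutativeSemigroup +-commutativeSemigroup
  using () renaming (interchange to +-interchange)
open import Algebra.Properties.CommutativeSemigroup *-commutativeSemigroup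
  using (x∙yz≈y∙xz; x∙yz≈xz∙y) renaming (interchange to *-interchange)
open import Algebra.Properties.Semiring.Sum +-*-semiring
  using (sum; sum-syntax; ∑-distrib-+; *-distribˡ-sum; *-distribʳ-sum; sum-cong-≗)
open import Data.Bool using (Bool; true; false; T; _∧_; _∨_; not)
open import Data.Bool.Properties using (T?; T-∧; ∧-zeroʳ; ∧-assoc)
open import Data.Fin using (Fin; zero; suc; _≟_)
open import Data.Fin.Properties using (any?)
open import Data.Vec.Functional using () renaming (_∷_ to _◃_)
open import Data.Fin.Subset using (Subset; inside; outside; ∣_∣)
open import Data.Vec using ([]; _∷_; lookup; _[_]≔_)
open import Data.Vec.Properties using (lookup∘update; lookup∘update′)
open import Data.List using (List; []; _∷_; _++_; map; filterᵇ; length; tabulate; allFin)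
open import Data.Product using (Σ; ∃; _×_; _,_; proj₁; proj₂; map₁; map₂)
open import Data.Sum using (inj₁; inj₂)
open import Data.Empty using (⊥-elim)
open import Function using (id; _∘_; case_of_; _⇔_; mk⇔; Equivalence)
open import Function.Definitions using (Injective)
open import Relation.Nullary using (¬_; yes; no)
open import Relation.Nullary.Decidable using (⌊_⌋; _×-dec_)
open import Relation.Binary.PropositionalEquality

open +-*-Solver using (solve; _:+_; _:*_; _:=_; con)

⟦_⟧ : Bool → ℕ
⟦ true ⟧  = 1
⟦ false ⟧ = 0

⟦⟧-mono : ∀ {a b} → (T a → T b) → ⟦ a ⟧ ≤ ⟦ b ⟧
⟦⟧-mono {false}         _   = z≤n
⟦⟧-mono {true} {true}   _   = ≤-refl
⟦⟧-mono {true} {false} a⇒b = ⊥-elim (a⇒b _)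

⟦⟧-true : ∀ {b} → T b → ⟦ b ⟧ ≡ 1
⟦⟧-true {true} _ = refl

⟦⟧-∧ : ∀ a b → ⟦ a ∧ b ⟧ ≡ ⟦ a ⟧ * ⟦ b ⟧
⟦⟧-∧ true  b = sym (+-identityʳ _)
⟦⟧-∧ false b = refl

T-not⇒¬T : ∀ {b} → T (not b) → ¬ T b
T-not⇒¬T {false} _ ()

T-not-∨ : ∀ {a b} → T (not a ∨ b) ⇔ (T a → T b)
T-not-∨ {true}  = mk⇔ (λ b _ → b) (λ a⇒b → a⇒b _)
T-not-∨ {false} = mk⇔ (λ _ ()) (λ _ → _)

T-not-≟ : ∀ {n} {i j : Fin n} → T (not ⌊ i ≟ j ⌋) ⇔ (i ≢ j)
T-not-≟ {i = i} {j} with i ≟ j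
... | yes i≡j = mk⇔ (λ ()) (λ i≢j → i≢j i≡j)
... | no  i≢j = mk⇔ (λ _ → i≢j) (λ _ → _)

T-allᵇ-tabulate : ∀ {A : Set} {n} (p : A → Bool) (f : Fin n → A) →
                  T (allᵇ p (tabulate f)) ⇔ (∀ i → T (p (f i)))
T-allᵇ-tabulate {n = zero}  p f = mk⇔ (λ _ ()) (λ _ → _)
T-allᵇ-tabulate {n = suc n} p f = mk⇔
  (λ all → let (head , tail) = Equivalence.to T-∧ all in
           λ { zero → head ; (suc i) → Equivalence.to (T-allᵇ-tabulate p (f ∘ suc)) tail i })
  (λ all → Equivalence.from T-∧ (all zero , Equivalence.from (T-allᵇ-tabulate p (f ∘ suc)) (all ∘ suc)))

∑-mono-≤ : ∀ {n} {f g : Fin n → ℕ} → (∀ i → f i ≤ g i) → ∑[ i < n ] f i ≤ ∑[ i < n ] g i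
∑-mono-≤ {zero}  f≤g = z≤n
∑-mono-≤ {suc n} f≤g = +-mono-≤ (f≤g zero) (∑-mono-≤ (f≤g ∘ suc))

∑-const : ∀ n c → ∑[ i < n ] c ≡ n * c
∑-const zero    c = refl
∑-const (suc n) c = cong (c +_) (∑-const n c)

∑-≤-const : ∀ {n} {f : Fin n → ℕ} {c} → (∀ i → f i ≤ c) → ∑[ i < n ] f i ≤ n * c
∑-≤-const {n} {c = c} f≤c = ≤-trans (∑-mono-≤ f≤c) (≤-reflexive (∑-const n c))

∑-pos : ∀ {n} (f : Fin n → ℕ) → 0 < ∑[ i < n ] f i → ∃ λ i → 0 < f i
∑-pos {suc n} f pos with f zero in eq
... | suc _ = zero , subst (0 <_) (sym eq) (s≤s z≤n)
... | zero  with ∑-pos (f ∘ suc) pos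
...   | i , 0<fi = suc i , 0<fi

≟-sym : ∀ {n} (v w : Fin n) → ⌊ v ≟ w ⌋ ≡ ⌊ w ≟ v ⌋
≟-sym v w with v ≟ w | w ≟ v
... | yes _   | yes _   = refl
... | no  _   | no  _   = refl
... | yes v≡w | no  w≢v = ⊥-elim (w≢v (sym v≡w))
... | no  v≢w | yes w≡v = ⊥-elim (v≢w (sym w≡v))

∑-≟ : ∀ {n} (v : Fin n) → ∑[ w < n ] ⟦ ⌊ v ≟ w ⌋ ⟧ ≡ 1
∑-≟ {suc n} zero    = cong suc (trans (∑-const n 0) (*-zeroʳ n))
∑-≟ {suc n} (suc v) = trans (sum-cong-≗ (λ w → cong ⟦_⟧ (≟-suc w))) (∑-≟ v)
  where
  ≟-suc : ∀ w → ⌊ suc v ≟ suc w ⌋ ≡ ⌊ v ≟ w ⌋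
  ≟-suc w with v ≟ w
  ... | yes _ = refl
  ... | no  _ = refl

module _ {A : Set} where

  ∑ᴸ : List A → (A → ℕ) → ℕ
  ∑ᴸ []       f = 0
  ∑ᴸ (x ∷ xs) f = f x + ∑ᴸ xs f

  infixl 10 ∑ᴸ
  syntax ∑ᴸ xs (λ x → e) = ∑[ x ∈ xs ] e

  ∑ᴸ-mono-≤ : ∀ xs {f g : A → ℕ} → (∀ x → f x ≤ g x) → ∑[ x ∈ xs ] f x ≤ ∑[ x ∈ xs ] g x
  ∑ᴸ-mono-≤ []       f≤g = z≤n
  ∑ᴸ-mono-≤ (x ∷ xs) f≤g = +-mono-≤ (f≤g x) (∑ᴸ-mono-≤ xs f≤g)

  ∑ᴸ-cong : ∀ xs {f g : A → ℕ} → (∀ x → f x ≡ g x) → ∑[ x ∈ xs ] f x ≡ ∑[ x ∈ xs ] g x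
  ∑ᴸ-cong []       f≗g = refl
  ∑ᴸ-cong (x ∷ xs) f≗g = cong₂ _+_ (f≗g x) (∑ᴸ-cong xs f≗g)

  ∑ᴸ-++ : ∀ xs ys (f : A → ℕ) → ∑[ x ∈ xs ++ ys ] f x ≡ ∑[ x ∈ xs ] f x + ∑[ x ∈ ys ] f x
  ∑ᴸ-++ []       ys f = refl
  ∑ᴸ-++ (x ∷ xs) ys f = trans (cong (f x +_) (∑ᴸ-++ xs ys f)) (sym (+-assoc (f x) _ _))

  ∑ᴸ-const : ∀ xs c → ∑[ x ∈ xs ] c ≡ length xs * c
  ∑ᴸ-const []       c = refl
  ∑ᴸ-const (x ∷ xs) c = cong (c +_) (∑ᴸ-const xs c)

  ∑ᴸ-zero : ∀ xs → ∑[ x ∈ xs ] 0 ≡ 0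
  ∑ᴸ-zero xs = trans (∑ᴸ-const xs 0) (*-zeroʳ (length xs))

  ∑ᴸ-distrib-+ : ∀ xs (f g : A → ℕ) → ∑[ x ∈ xs ] (f x + g x) ≡ ∑[ x ∈ xs ] f x + ∑[ x ∈ xs ] g x
  ∑ᴸ-distrib-+ []       f g = refl
  ∑ᴸ-distrib-+ (x ∷ xs) f g =
    trans (cong (f x + g x +_) (∑ᴸ-distrib-+ xs f g)) (+-interchange (f x) (g x) _ _)

  *-distribʳ-∑ᴸ : ∀ xs (f : A → ℕ) c → ∑[ x ∈ xs ] (f x * c) ≡ (∑[ x ∈ xs ] f x) * c
  *-distribʳ-∑ᴸ []       f c = refl
  *-distribʳ-∑ᴸ (x ∷ xs) f c =
    trans (cong (f x * c +_) (*-distribʳ-∑ᴸ xs f c)) (sym (*-distribʳ-+ c (f x) _))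

  *-distribˡ-∑ᴸ : ∀ xs (f : A → ℕ) c → ∑[ x ∈ xs ] (c * f x) ≡ c * ∑[ x ∈ xs ] f x
  *-distribˡ-∑ᴸ xs f c = begin
    ∑[ x ∈ xs ] (c * f x)   ≡⟨ ∑ᴸ-cong xs (λ x → *-comm c (f x)) ⟩
    ∑[ x ∈ xs ] (f x * c)   ≡⟨ *-distribʳ-∑ᴸ xs f c ⟩
    (∑[ x ∈ xs ] f x) * c   ≡⟨ *-comm _ c ⟩
    c * ∑[ x ∈ xs ] f x     ∎
    where open ≡-Reasoning

  ∑ᴸ-comm : ∀ xs ys (h : A → A → ℕ) →
            ∑[ x ∈ xs ] ∑[ y ∈ ys ] h x y ≡ ∑[ y ∈ ys ] ∑[ x ∈ xs ] h x y
  ∑ᴸ-comm []       ys h = sym (∑ᴸ-zero ys)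
  ∑ᴸ-comm (x ∷ xs) ys h = trans (cong (∑[ y ∈ ys ] h x y +_) (∑ᴸ-comm xs ys h))
                                (sym (∑ᴸ-distrib-+ ys (h x) (λ y → ∑[ x ∈ xs ] h x y)))

  ∑ᴸ-∑-comm : ∀ {n} xs (h : A → Fin n → ℕ) →
              ∑[ x ∈ xs ] ∑[ i < n ] h x i ≡ ∑[ i < n ] ∑[ x ∈ xs ] h x i
  ∑ᴸ-∑-comm {n} []       h = sym (trans (∑-const n 0) (*-zeroʳ n))
  ∑ᴸ-∑-comm     (x ∷ xs) h = trans (cong (sum (h x) +_) (∑ᴸ-∑-comm xs h))
                                   (sym (∑-distrib-+ (h x) (λ i → ∑[ x ∈ xs ] h x i)))

  length-filterᵇ : ∀ (p : A → Bool) xs → length (filterᵇ p xs) ≡ ∑[ x ∈ xs ] ⟦ p x ⟧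
  length-filterᵇ p []       = refl
  length-filterᵇ p (x ∷ xs) with p x
  ... | true  = cong suc (length-filterᵇ p xs)
  ... | false = length-filterᵇ p xs

  ∑ᴸ-filterᵇ : ∀ (p : A → Bool) xs (f : A → ℕ) →
               ∑[ x ∈ filterᵇ p xs ] f x ≡ ∑[ x ∈ xs ] (⟦ p x ⟧ * f x)
  ∑ᴸ-filterᵇ p []       f = refl
  ∑ᴸ-filterᵇ p (x ∷ xs) f with p x
  ... | true  = cong₂ _+_ (sym (+-identityʳ (f x))) (∑ᴸ-filterᵇ p xs f)
  ... | false = ∑ᴸ-filterᵇ p xs f

∑ᴸ-map : ∀ {A B : Set} (g : A → B) xs (f : B → ℕ) → ∑[ y ∈ map g xs ] f y ≡ ∑[ x ∈ xs ] f (g x)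
∑ᴸ-map g []       f = refl
∑ᴸ-map g (x ∷ xs) f = cong (f (g x) +_) (∑ᴸ-map g xs f)

-- Chebyshev's sum inequality and the power mean inequality

rearrangement : ∀ {a b c d} → a ≤ b → c ≤ d → a * d + b * c ≤ a * c + b * d
rearrangement {a} {b} {c} {d} a≤b c≤d =
  subst₂ (λ b d → a * d + b * c ≤ a * c + b * d) (m+[n∸m]≡n a≤b) (m+[n∸m]≡n c≤d)
    (subst (a * (c + y) + (a + x) * c ≤_) (sym (expand a c x y)) (m≤m+n _ (x * y)))
  where
  x = b ∸ a
  y = d ∸ c
  expand : ∀ a c x y → a * c + (a + x) * (c + y) ≡ a * (c + y) + (a + x) * c + x * y
  expand = solve 4 (λ a c x y → a :* c :+ (a :+ x) :* (c :+ y)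
                              := a :* (c :+ y) :+ (a :+ x) :* c :+ x :* y) refl

pow-rearrangement : ∀ a b k → a * b ^ k + b * a ^ k ≤ a * a ^ k + b * b ^ k
pow-rearrangement a b k with ≤-total a b
... | inj₁ a≤b = rearrangement a≤b (^-monoˡ-≤ k a≤b)
... | inj₂ b≤a = subst₂ _≤_ (+-comm (b * a ^ k) _) (+-comm (b * b ^ k) _)
                        (rearrangement b≤a (^-monoˡ-≤ k b≤a))

module _ {A : Set} where

  ∑ᴸ-*-∑ᴸ : ∀ xs (f g : A → ℕ) →
            (∑[ x ∈ xs ] f x) * (∑[ y ∈ xs ] g y) ≡ ∑[ x ∈ xs ] ∑[ y ∈ xs ] (f x * g y)
  ∑ᴸ-*-∑ᴸ xs f g = trans (sym (*-distribʳ-∑ᴸ xs f _))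
                         (∑ᴸ-cong xs (λ x → sym (*-distribˡ-∑ᴸ xs g (f x))))

  chebyshev : ∀ xs (f g : A → ℕ) →
              (∀ x y → f x * g y + f y * g x ≤ f x * g x + f y * g y) →
              (∑[ x ∈ xs ] f x) * (∑[ x ∈ xs ] g x) ≤ length xs * ∑[ x ∈ xs ] (f x * g x)
  chebyshev xs f g similarly-ordered = *-cancelˡ-≤ 2 (begin
    2 * (F * G)
      ≡⟨ double (F * G) ⟩
    F * G + F * G
      ≡⟨ cong₂ _+_ (∑ᴸ-*-∑ᴸ xs f g) (trans (∑ᴸ-*-∑ᴸ xs f g) (∑ᴸ-comm xs xs (λ x y → f x * g y))) ⟩
    ∑[ x ∈ xs ] ∑[ y ∈ xs ] (f x * g y) + ∑[ x ∈ xs ] ∑[ y ∈ xs ] (f y * g x)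
      ≡⟨ sym (∑ᴸ-distrib-+ xs _ _) ⟩
    ∑[ x ∈ xs ] (∑[ y ∈ xs ] (f x * g y) + ∑[ y ∈ xs ] (f y * g x))
      ≡⟨ ∑ᴸ-cong xs (λ x → sym (∑ᴸ-distrib-+ xs _ _)) ⟩
    ∑[ x ∈ xs ] ∑[ y ∈ xs ] (f x * g y + f y * g x)
      ≤⟨ ∑ᴸ-mono-≤ xs (λ x → ∑ᴸ-mono-≤ xs (similarly-ordered x)) ⟩
    ∑[ x ∈ xs ] ∑[ y ∈ xs ] (fg x + fg y)
      ≡⟨ ∑ᴸ-cong xs (λ x → ∑ᴸ-distrib-+ xs (λ _ → fg x) fg) ⟩
    ∑[ x ∈ xs ] (∑[ y ∈ xs ] fg x + FG)
      ≡⟨ ∑ᴸ-distrib-+ xs _ _ ⟩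
    ∑[ x ∈ xs ] ∑[ y ∈ xs ] fg x + ∑[ x ∈ xs ] FG
      ≡⟨ cong₂ _+_ (trans (∑ᴸ-cong xs (λ x → ∑ᴸ-const xs (fg x))) (*-distribˡ-∑ᴸ xs fg L))
                   (∑ᴸ-const xs FG) ⟩
    L * FG + L * FG
      ≡⟨ sym (double (L * FG)) ⟩
    2 * (L * FG)
      ∎)
    where
    open ≤-Reasoning
    fg : A → ℕ
    fg x = f x * g x
    F = ∑[ x ∈ xs ] f x
    G = ∑[ x ∈ xs ] g x
    FG = ∑[ x ∈ xs ] fg x
    L = length xs
    double : ∀ z → 2 * z ≡ z + z
    double z = cong (z +_) (+-identityʳ z)

  power-mean : ∀ xs (a : A → ℕ) k →
               (∑[ x ∈ xs ] a x) ^ suc k ≤ length xs ^ k * ∑[ x ∈ xs ] (a x ^ suc k)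
  power-mean xs a zero = begin
    S * 1                   ≡⟨ *-identityʳ S ⟩
    S                       ≡⟨ ∑ᴸ-cong xs (λ x → sym (*-identityʳ (a x))) ⟩
    ∑[ x ∈ xs ] (a x ^ 1)     ≡⟨ sym (*-identityˡ _) ⟩
    1 * ∑[ x ∈ xs ] (a x ^ 1) ∎
    where
    open ≤-Reasoning
    S = ∑[ x ∈ xs ] a x
  power-mean xs a (suc k) = begin
    S * S ^ suc k                ≤⟨ *-monoʳ-≤ S (power-mean xs a k) ⟩
    S * (L ^ k * P)              ≡⟨ x∙yz≈y∙xz S (L ^ k) P ⟩
    L ^ k * (S * P)              ≤⟨ *-monoʳ-≤ (L ^ k) (chebyshev xs a (λ x → a x ^ suc k)
                                                         (λ x y → pow-rearrangement (a x) (a y) (suc k))) ⟩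
    L ^ k * (L * P′)             ≡⟨ x∙yz≈y∙xz (L ^ k) L P′ ⟩
    L * (L ^ k * P′)             ≡⟨ sym (*-assoc L _ P′) ⟩
    L * L ^ k * P′               ∎
    where
    open ≤-Reasoning
    S = ∑[ x ∈ xs ] a x
    L = length xs
    P = ∑[ x ∈ xs ] (a x ^ suc k)
    P′ = ∑[ x ∈ xs ] (a x ^ suc (suc k))

^-distribʳ-* : ∀ m n k → (m * n) ^ k ≡ m ^ k * n ^ k
^-distribʳ-* m n zero    = refl
^-distribʳ-* m n (suc k) = trans (cong (m * n *_) (^-distribʳ-* m n k)) (*-interchange m n (m ^ k) (n ^ k))

offset : ℕ → ℕ → ℕ
offset r zero          = 0
offset r (suc zero)    = 0
offset r (suc (suc s)) = r ^ suc (suc s)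

offset≤^ : ∀ r s → offset r s ≤ r ^ s
offset≤^ r zero          = z≤n
offset≤^ r (suc zero)    = z≤n
offset≤^ r (suc (suc s)) = ≤-refl

r^[e*e]≤[2*[r+e]^e]^e : ∀ r e → r ^ (e * e) ≤ (2 * (r + e) ^ e) ^ e
r^[e*e]≤[2*[r+e]^e]^e r e = begin
  r ^ (e * e)               ≤⟨ ^-monoˡ-≤ (e * e) (m≤m+n r e) ⟩
  (r + e) ^ (e * e)         ≡⟨ sym (^-*-assoc (r + e) e e) ⟩
  ((r + e) ^ e) ^ e         ≤⟨ m≤n*m _ (2 ^ e) {{m^n≢0 2 e}} ⟩
  2 ^ e * ((r + e) ^ e) ^ e ≡⟨ sym (^-distribʳ-* 2 ((r + e) ^ e) e) ⟩
  (2 * (r + e) ^ e) ^ e     ∎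
  where open ≤-Reasoning

offset^k≤ : ∀ r t k → offset r (suc t) ^ k ≤ (suc t + r) ^ (suc t * suc k)
offset^k≤ r t k = begin
  offset r (suc t) ^ k        ≤⟨ ^-monoˡ-≤ k (≤-trans (offset≤^ r (suc t)) (^-monoˡ-≤ (suc t) (m≤n+m r (suc t)))) ⟩
  ((suc t + r) ^ suc t) ^ k   ≡⟨ ^-*-assoc (suc t + r) (suc t) k ⟩
  (suc t + r) ^ (suc t * k)   ≤⟨ ^-monoʳ-≤ (suc t + r) (*-monoʳ-≤ (suc t) (n≤1+n k)) ⟩
  (suc t + r) ^ (suc t * suc k) ∎
  where open ≤-Reasoning

offset-step : ∀ r s → r * offset r (suc s) ≤ offset r (suc (suc s))
offset-step r zero    = ≤-trans (≤-reflexive (*-zeroʳ r)) z≤n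
offset-step r (suc s) = ≤-refl

offset-gap : ∀ p k → suc p + suc (suc p) * suc p ^ suc (suc k) ≤ suc p * suc (suc p) ^ suc (suc k)
offset-gap p k = begin
  p′ + r * (p′ * p′ ^ suc k)     ≤⟨ +-monoˡ-≤ _ (m≤m*n p′ r) ⟩
  p′ * r + r * (p′ * p′ ^ suc k) ≡⟨ solve 3 (λ a b x → a :* b :+ b :* (a :* x) := a :* (b :* (con 1 :+ x)))
                                           refl p′ r (p′ ^ suc k) ⟩
  p′ * (r * suc (p′ ^ suc k))    ≤⟨ *-monoʳ-≤ p′ (*-monoʳ-≤ r (^-monoˡ-< (suc k) (n<1+n p′))) ⟩
  p′ * (r * r ^ suc k)           ∎
  where
  open ≤-Reasoning
  p′ = suc p
  r = suc p′

∸-scale : ∀ {p r d N B B′} → p * (d ∸ 1) ≤ r * N → p + r * B′ ≤ p * B → p * (d ∸ B) ≤ r * (N ∸ B′)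
∸-scale {p} {r} {d} {N} {B} {B′} lin gap = begin
  p * (d ∸ B)           ≡⟨ *-distribˡ-∸ p d B ⟩
  p * d ∸ p * B         ≤⟨ ∸-monoʳ-≤ (p * d) gap ⟩
  p * d ∸ (p + r * B′)  ≡⟨ sym (∸-+-assoc (p * d) p (r * B′)) ⟩
  p * d ∸ p ∸ r * B′    ≡⟨ cong (λ z → p * d ∸ z ∸ r * B′) (sym (*-identityʳ p)) ⟩
  p * d ∸ p * 1 ∸ r * B′ ≡⟨ cong (_∸ r * B′) (sym (*-distribˡ-∸ p d 1)) ⟩
  p * (d ∸ 1) ∸ r * B′  ≤⟨ ∸-monoˡ-≤ (r * B′) lin ⟩
  r * N ∸ r * B′        ≡⟨ sym (*-distribˡ-∸ r N B′) ⟩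
  r * (N ∸ B′)          ∎
  where open ≤-Reasoning

pow-transfer : ∀ {p r D M X} e′ → .{{NonZero p}} → p ≤ r → p * D ≤ r * M →
               M ^ suc e′ ≤ p ^ (suc e′ * suc e′) * X → D ^ suc e′ ≤ r ^ (suc e′ * suc e′) * X
pow-transfer {p} {r} {D} {M} {X} e′ p≤r pD≤rM M^e≤ = *-cancelˡ-≤ (p ^ e) {{m^n≢0 p e}} (begin
  p ^ e * D ^ e                   ≡⟨ sym (^-distribʳ-* p D e) ⟩
  (p * D) ^ e                     ≤⟨ ^-monoˡ-≤ e pD≤rM ⟩
  (r * M) ^ e                     ≡⟨ ^-distribʳ-* r M e ⟩
  r ^ e * M ^ e                   ≤⟨ *-monoʳ-≤ (r ^ e) M^e≤ ⟩
  r ^ e * (p ^ (e + f) * X)       ≡⟨ cong (λ z → r ^ e * (z * X)) (^-distribˡ-+-* p e f) ⟩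
  r ^ e * (p ^ e * p ^ f * X)     ≡⟨ solve 4 (λ a b c x → a :* (b :* c :* x) := b :* (a :* c :* x))
                                            refl (r ^ e) (p ^ e) (p ^ f) X ⟩
  p ^ e * (r ^ e * p ^ f * X)     ≤⟨ *-monoʳ-≤ (p ^ e) (*-monoˡ-≤ X (*-monoʳ-≤ (r ^ e) (^-monoˡ-≤ f p≤r))) ⟩
  p ^ e * (r ^ e * r ^ f * X)     ≡⟨ cong (λ z → p ^ e * (z * X)) (sym (^-distribˡ-+-* r e f)) ⟩
  p ^ e * (r ^ (e + f) * X)       ∎)
  where
  open ≤-Reasoning
  e = suc e′
  f = e′ * e

sparse-arith : ∀ p N M → suc p * N < p * (N + M) → suc (N + M) ≤ suc p * M
sparse-arith p N M rN<p[N+M] with suc (N + M) ≤? suc p * M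
... | yes d≤rM = d≤rM
... | no  d≰rM = ⊥-elim (<-irrefl refl (begin-strict
  r * (N + M)          ≡⟨ *-distribˡ-+ r N M ⟩
  r * N + r * M        <⟨ +-mono-<-≤ rN<p[N+M] (≤-pred (≰⇒> d≰rM)) ⟩
  p * (N + M) + (N + M) ≡⟨ +-comm (p * (N + M)) _ ⟩
  r * (N + M)          ∎))
  where
  open ≤-Reasoning
  r = suc p

VertexSet : ℕ → Set
VertexSet n = Fin n → Bool

module _ {n : ℕ} where

  infixr 8 _∩_
  infix 4 _⊆_

  _∩_ : VertexSet n → VertexSet n → VertexSet n
  (u ∩ c) w = u w ∧ c w

  _⊆_ : VertexSet n → VertexSet n → Set
  u ⊆ u′ = ∀ w → T (u w) → T (u′ w)

  full : VertexSet n
  full _ = true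

  card : VertexSet n → ℕ
  card u = ∑[ w < n ] ⟦ u w ⟧

  ∩⊆ˡ : ∀ u c → u ∩ c ⊆ u
  ∩⊆ˡ u c w = proj₁ ∘ Equivalence.to T-∧

  ∩-monoˡ : ∀ {u u′} c → u ⊆ u′ → u ∩ c ⊆ u′ ∩ c
  ∩-monoˡ c u⊆u′ w p = let (uw , cw) = Equivalence.to T-∧ p in Equivalence.from T-∧ (u⊆u′ w uw , cw)

  card-mono : ∀ {u u′} → u ⊆ u′ → card u ≤ card u′
  card-mono u⊆u′ = ∑-mono-≤ (λ w → ⟦⟧-mono (u⊆u′ w))

  card-full : card full ≡ n
  card-full = trans (∑-const n 1) (*-identityʳ n)

  card-empty : ∀ u → (∀ w → ¬ T (u w)) → card u ≡ 0
  card-empty u empty = trans (sum-cong-≗ (λ w → ⟦⟧-false (empty w))) (trans (∑-const n 0) (*-zeroʳ n))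
    where
    ⟦⟧-false : ∀ {b} → ¬ T b → ⟦ b ⟧ ≡ 0
    ⟦⟧-false {false} _ = refl
    ⟦⟧-false {true}  ¬t = ⊥-elim (¬t _)

  Pairwise : ∀ {k} → (Fin n → Fin n → Bool) → (Fin k → Fin n) → Set
  Pairwise E f = ∀ i j → i ≢ j → T (E (f i) (f j))

  TupleIn : ∀ {k} → (Fin n → Fin n → Bool) → VertexSet n → (Fin k → Fin n) → Set
  TupleIn E u f = Pairwise E f × (∀ i → T (u (f i)))

  TupleIn-mono : ∀ {k E u u′} {f : Fin k → Fin n} → u ⊆ u′ → TupleIn E u f → TupleIn E u′ f
  TupleIn-mono u⊆u′ (pairwise , members) = pairwise , λ i → u⊆u′ _ (members i)

  pairwise-injective : ∀ {k E} {f : Fin k → Fin n} → (∀ v → ¬ T (E v v)) → Pairwise E f → Injective _≡_ _≡_ f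
  pairwise-injective {E = E} {f = f} irrefl pairwise {i} {j} fi≡fj with i ≟ j
  ... | yes i≡j = i≡j
  ... | no  i≢j = ⊥-elim (irrefl (f j) (subst (λ v → T (E v (f j))) fi≡fj (pairwise i j i≢j)))

  ◃-tupleIn : ∀ {k E u v} {f : Fin k → Fin n} → (∀ v w → E v w ≡ E w v) →
              T (u v) → TupleIn E (u ∩ E v) f → TupleIn E u (v ◃ f)
  ◃-tupleIn {E = E} {u} {v} {f} E-sym uv (pairwise , members) = pairwise′ , members′
    where
    members′ : ∀ i → T (u ((v ◃ f) i))
    members′ zero    = uv
    members′ (suc i) = proj₁ (Equivalence.to T-∧ (members i))
    Ev : ∀ i → T (E v (f i))
    Ev i = proj₂ (Equivalence.to (T-∧ {u (f i)}) (members i))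
    pairwise′ : Pairwise E (v ◃ f)
    pairwise′ zero    zero    0≢0 = ⊥-elim (0≢0 refl)
    pairwise′ zero    (suc j) _   = Ev j
    pairwise′ (suc i) zero    _   = subst T (E-sym v (f i)) (Ev i)
    pairwise′ (suc i) (suc j) i≢j = pairwise i j (i≢j ∘ cong suc)

∑-allSubsets-suc : ∀ n (f : Subset (suc n) → ℕ) →
  ∑[ S ∈ allSubsets (suc n) ] f S
    ≡ ∑[ S ∈ allSubsets n ] f (outside ∷ S) + ∑[ S ∈ allSubsets n ] f (inside ∷ S)
∑-allSubsets-suc n f = trans (∑ᴸ-++ (map (outside ∷_) (allSubsets n)) _ f)
  (cong₂ _+_ (∑ᴸ-map (outside ∷_) (allSubsets n) f) (∑ᴸ-map (inside ∷_) (allSubsets n) f))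

∣∣≡card : ∀ {n} (S : Subset n) → ∣ S ∣ ≡ card (lookup S)
∣∣≡card []          = refl
∣∣≡card (true ∷ S)  = cong suc (∣∣≡card S)
∣∣≡card (false ∷ S) = ∣∣≡card S

∣∣-insert : ∀ {n} (Q : Subset n) v → lookup Q v ≡ false → ∣ Q [ v ]≔ inside ∣ ≡ suc ∣ Q ∣
∣∣-insert (x ∷ Q)     zero    Qv≡false rewrite Qv≡false = refl
∣∣-insert (true ∷ Q)  (suc v) Qv≡false = cong suc (∣∣-insert Q v Qv≡false)
∣∣-insert (false ∷ Q) (suc v) Qv≡false = ∣∣-insert Q v Qv≡false

∑-insert : ∀ {n} (v : Fin n) (f : Subset n → ℕ) →
  ∑[ S ∈ allSubsets n ] (⟦ lookup S v ⟧ * f S)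
    ≡ ∑[ Q ∈ allSubsets n ] (⟦ not (lookup Q v) ⟧ * f (Q [ v ]≔ inside))
∑-insert {suc n} zero f =
  trans (∑-allSubsets-suc n _)
        (trans (+-comm (∑[ S ∈ allSubsets n ] 0) (∑[ S ∈ allSubsets n ] (f (inside ∷ S) + 0)))
               (sym (∑-allSubsets-suc n _)))
∑-insert {suc n} (suc v) f = begin
  ∑[ S ∈ allSubsets (suc n) ] (⟦ lookup S (suc v) ⟧ * f S)
    ≡⟨ ∑-allSubsets-suc n _ ⟩
  ∑[ S ∈ allSubsets n ] (⟦ lookup S v ⟧ * f (outside ∷ S))
    + ∑[ S ∈ allSubsets n ] (⟦ lookup S v ⟧ * f (inside ∷ S))
    ≡⟨ cong₂ _+_ (∑-insert v (f ∘ (outside ∷_))) (∑-insert v (f ∘ (inside ∷_))) ⟩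
  ∑[ Q ∈ allSubsets n ] (⟦ not (lookup Q v) ⟧ * f (outside ∷ Q [ v ]≔ inside))
    + ∑[ Q ∈ allSubsets n ] (⟦ not (lookup Q v) ⟧ * f (inside ∷ Q [ v ]≔ inside))
    ≡⟨ sym (∑-allSubsets-suc n _) ⟩
  ∑[ Q ∈ allSubsets (suc n) ] (⟦ not (lookup Q (suc v)) ⟧ * f (Q [ suc v ]≔ inside))
    ∎
  where open ≡-Reasoning

infix 7 _⊆ᵇ_

_⊆ᵇ_ : ∀ {n} → Subset n → VertexSet n → Bool
[]      ⊆ᵇ c = true
(x ∷ Q) ⊆ᵇ c = (not x ∨ c zero) ∧ (Q ⊆ᵇ c ∘ suc)

T-⊆ᵇ : ∀ {n} (Q : Subset n) (c : VertexSet n) → T (Q ⊆ᵇ c) ⇔ (lookup Q ⊆ c)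
T-⊆ᵇ Q c = mk⇔ (to Q c) (from Q c)
  where
  to : ∀ {n} (Q : Subset n) c → T (Q ⊆ᵇ c) → lookup Q ⊆ c
  to (true ∷ Q) c p zero    _  = proj₁ (Equivalence.to T-∧ p)
  to (x ∷ Q)    c p (suc j) Qj = to Q (c ∘ suc) (proj₂ (Equivalence.to (T-∧ {not x ∨ c zero}) p)) j Qj
  from : ∀ {n} (Q : Subset n) c → lookup Q ⊆ c → T (Q ⊆ᵇ c)
  from []          c Q⊆c = _
  from (true ∷ Q)  c Q⊆c = Equivalence.from T-∧ (Q⊆c zero _ , from Q (c ∘ suc) (Q⊆c ∘ suc))
  from (false ∷ Q) c Q⊆c = from Q (c ∘ suc) (Q⊆c ∘ suc)

⊆ᵇ-full : ∀ {n} (Q : Subset n) → T (Q ⊆ᵇ full)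
⊆ᵇ-full Q = Equivalence.from (T-⊆ᵇ Q full) (λ _ _ → _)

subsets-within : ∀ n (c : VertexSet n) k → ∑[ Q ∈ allSubsets n ] ⟦ Q ⊆ᵇ c ∧ (∣ Q ∣ ≡ᵇ k) ⟧ ≤ card c ^ k
subsets-within zero    c zero    = ≤-refl
subsets-within zero    c (suc k) = z≤n
subsets-within (suc n) c k = begin
  ∑[ Q ∈ allSubsets (suc n) ] ⟦ Q ⊆ᵇ c ∧ (∣ Q ∣ ≡ᵇ k) ⟧
    ≡⟨ ∑-allSubsets-suc n _ ⟩
  ∑[ Q ∈ allSubsets n ] ⟦ Q ⊆ᵇ c′ ∧ (∣ Q ∣ ≡ᵇ k) ⟧
    + ∑[ Q ∈ allSubsets n ] ⟦ (c zero ∧ Q ⊆ᵇ c′) ∧ (suc ∣ Q ∣ ≡ᵇ k) ⟧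
    ≤⟨ +-monoˡ-≤ _ (subsets-within n c′ k) ⟩
  card c′ ^ k + ∑[ Q ∈ allSubsets n ] ⟦ (c zero ∧ Q ⊆ᵇ c′) ∧ (suc ∣ Q ∣ ≡ᵇ k) ⟧
    ≤⟨ add-first-vertex (c zero) k ⟩
  (⟦ c zero ⟧ + card c′) ^ k
    ∎
  where
  open ≤-Reasoning
  c′ = c ∘ suc
  add-first-vertex : ∀ b k → card c′ ^ k + ∑[ Q ∈ allSubsets n ] ⟦ (b ∧ Q ⊆ᵇ c′) ∧ (suc ∣ Q ∣ ≡ᵇ k) ⟧
                             ≤ (⟦ b ⟧ + card c′) ^ k
  add-first-vertex false k = ≤-reflexive (trans (cong (card c′ ^ k +_) (∑ᴸ-zero (allSubsets n))) (+-identityʳ _))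
  add-first-vertex true zero = ≤-reflexive (cong suc (trans (∑ᴸ-cong (allSubsets n) (λ Q → cong ⟦_⟧ (∧-zeroʳ _)))
                                                        (∑ᴸ-zero (allSubsets n))))
  add-first-vertex true (suc k) = begin
    X * X ^ k + ∑[ Q ∈ allSubsets n ] ⟦ Q ⊆ᵇ c′ ∧ (∣ Q ∣ ≡ᵇ k) ⟧
      ≤⟨ +-monoʳ-≤ (X * X ^ k) (subsets-within n c′ k) ⟩
    X * X ^ k + X ^ k
      ≡⟨ +-comm (X * X ^ k) (X ^ k) ⟩
    suc X * X ^ k
      ≤⟨ *-monoʳ-≤ (suc X) (^-monoˡ-≤ k (n≤1+n X)) ⟩
    suc X * suc X ^ k
      ∎
    where X = card c′

-- Supersaturation

module _ {n : ℕ} (G : Graph n) where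

  nonadj : Fin n → Fin n → Bool
  nonadj v w = not ⌊ v ≟ w ⌋ ∧ not (adj G v w)

  HasClique : ℕ → VertexSet n → Set
  HasClique k u = Σ (Fin k → Fin n) (TupleIn (adj G) u)

  indep : ℕ → VertexSet n → ℕ
  indep zero    u = 1
  indep (suc s) u = ∑[ v < n ] (⟦ u v ⟧ * indep s (u ∩ nonadj v))

  indep-mono : ∀ s {u u′} → u ⊆ u′ → indep s u ≤ indep s u′
  indep-mono zero    u⊆u′ = ≤-refl
  indep-mono (suc s) u⊆u′ =
    ∑-mono-≤ (λ v → *-mono-≤ (⟦⟧-mono (u⊆u′ v)) (indep-mono s (∩-monoˡ (nonadj v) u⊆u′)))

  card-split : ∀ u v → T (u v) → card u ≡ suc (card (u ∩ adj G v) + card (u ∩ nonadj v))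
  card-split u v uv = begin
    ∑[ w < n ] ⟦ u w ⟧
      ≡⟨ sum-cong-≗ split ⟩
    ∑[ w < n ] (⟦ ⌊ v ≟ w ⌋ ⟧ + (⟦ (u ∩ adj G v) w ⟧ + ⟦ (u ∩ nonadj v) w ⟧))
      ≡⟨ ∑-distrib-+ (λ w → ⟦ ⌊ v ≟ w ⌋ ⟧) _ ⟩
    ∑[ w < n ] ⟦ ⌊ v ≟ w ⌋ ⟧ + ∑[ w < n ] (⟦ (u ∩ adj G v) w ⟧ + ⟦ (u ∩ nonadj v) w ⟧)
      ≡⟨ cong₂ _+_ (∑-≟ v) (∑-distrib-+ (λ w → ⟦ (u ∩ adj G v) w ⟧) _) ⟩
    suc (card (u ∩ adj G v) + card (u ∩ nonadj v))
      ∎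
    where
    open ≡-Reasoning
    split : ∀ w → ⟦ u w ⟧ ≡ ⟦ ⌊ v ≟ w ⌋ ⟧ + (⟦ u w ∧ adj G v w ⟧ + ⟦ u w ∧ nonadj v w ⟧)
    split w with v ≟ w
    split w | yes refl with u v | adj G v v | irrefl G v
    ...   | true  | false | _ = refl
    ...   | false | _     | _ = ⊥-elim uv
    split w | no _ with u w | adj G v w
    ...   | true  | true  = refl
    ...   | true  | false = refl
    ...   | false | _     = refl

  Supersaturated : ℕ → ℕ → VertexSet n → Set
  Supersaturated r s u = (card u ∸ offset r s) ^ s ≤ r ^ (s * s) * indep s u

  dense-step : ∀ q s u v → T (u v) →
    suc q * (card u ∸ 1) ≤ suc (suc q) * card (u ∩ adj G v) →
    Supersaturated (suc q) (suc (suc s)) (u ∩ adj G v) → Supersaturated (suc (suc q)) (suc (suc s)) u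
  dense-step q s u v uv dense ih =
    pow-transfer {p} {r} {d ∸ B} {N ∸ B′} {indep e u} (suc s) (n≤1+n p)
      (∸-scale {p} {r} {d} {N} {B} {B′} dense (offset-gap q s))
      (≤-trans ih (*-monoʳ-≤ (p ^ (e * e)) (indep-mono e (∩⊆ˡ u (adj G v)))))
    where
    p = suc q
    r = suc p
    e = suc (suc s)
    d = card u
    N = card (u ∩ adj G v)
    B = offset r e
    B′ = offset p e

  sparse-vertex : ∀ p u v → T (u v) → suc p * card (u ∩ adj G v) < p * (card u ∸ 1) →
                  card u ≤ suc p * card (u ∩ nonadj v)
  sparse-vertex p u v uv sparse = subst (_≤ suc p * M) (sym (card-split u v uv))
    (sparse-arith p N M (subst (λ d → suc p * N < p * (d ∸ 1)) (card-split u v uv) sparse))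
    where
    N = card (u ∩ adj G v)
    M = card (u ∩ nonadj v)

  sparse-step : ∀ r s u → .{{NonZero r}} →
    (∀ v → T (u v) → card u ≤ r * card (u ∩ nonadj v)) →
    (∀ v → Supersaturated r (suc s) (u ∩ nonadj v)) → Supersaturated r (suc (suc s)) u
  sparse-step r s u sparse ih = begin
    (d ∸ A) * P                           ≤⟨ *-monoˡ-≤ P (m∸n≤m d A) ⟩
    d * P                                 ≡⟨ *-distribʳ-sum P (λ v → ⟦ u v ⟧) ⟩
    ∑[ v < n ] (⟦ u v ⟧ * P)              ≤⟨ ∑-mono-≤ per-vertex ⟩
    ∑[ v < n ] (⟦ u v ⟧ * (C * I v))      ≡⟨ sum-cong-≗ (λ v → x∙yz≈xz∙y ⟦ u v ⟧ C (I v)) ⟩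
    ∑[ v < n ] (⟦ u v ⟧ * I v * C)        ≡⟨ sym (*-distribʳ-sum C (λ v → ⟦ u v ⟧ * I v)) ⟩
    indep (suc (suc s)) u * C             ≡⟨ *-comm _ C ⟩
    C * indep (suc (suc s)) u             ≤⟨ *-monoˡ-≤ _ C≤ ⟩
    r ^ (suc (suc s) * suc (suc s)) * indep (suc (suc s)) u ∎
    where
    open ≤-Reasoning
    d = card u
    A = offset r (suc (suc s))
    A′ = offset r (suc s)
    P = (d ∸ A) ^ suc s
    C = r ^ suc s * r ^ (suc s * suc s)
    I : Fin n → ℕ
    I v = indep (suc s) (u ∩ nonadj v)
    square-suc : suc (suc s) * suc (suc s) ≡ suc s + suc s * suc s + (2 + s)
    square-suc = solve 1 (λ s → (con 2 :+ s) :* (con 2 :+ s)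
                                := (con 1 :+ s) :+ (con 1 :+ s) :* (con 1 :+ s) :+ (con 2 :+ s)) refl s
    C≤ : C ≤ r ^ (suc (suc s) * suc (suc s))
    C≤ = ≤-trans (≤-reflexive (sym (^-distribˡ-+-* r (suc s) (suc s * suc s))))
                 (^-monoʳ-≤ r (subst (suc s + suc s * suc s ≤_) (sym square-suc) (m≤m+n _ _)))
    per-vertex : ∀ v → ⟦ u v ⟧ * P ≤ ⟦ u v ⟧ * (C * I v)
    per-vertex v with u v in uv
    ... | false = z≤n
    ... | true  = *-monoʳ-≤ 1 (begin
      (d ∸ A) ^ suc s                   ≤⟨ ^-monoˡ-≤ (suc s) d∸A≤ ⟩
      (r * (M ∸ A′)) ^ suc s            ≡⟨ ^-distribʳ-* r (M ∸ A′) (suc s) ⟩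
      r ^ suc s * (M ∸ A′) ^ suc s      ≤⟨ *-monoʳ-≤ (r ^ suc s) (ih v) ⟩
      r ^ suc s * (r ^ (suc s * suc s) * I v) ≡⟨ sym (*-assoc (r ^ suc s) _ _) ⟩
      C * I v                           ∎)
      where
      M = card (u ∩ nonadj v)
      d∸A≤ : d ∸ A ≤ r * (M ∸ A′)
      d∸A≤ = begin
        d ∸ A              ≤⟨ ∸-monoʳ-≤ d (offset-step r s) ⟩
        d ∸ r * A′         ≤⟨ ∸-monoˡ-≤ (r * A′) (sparse v (subst T (sym uv) _)) ⟩
        r * M ∸ r * A′     ≡⟨ sym (*-distribˡ-∸ r M A′) ⟩
        r * (M ∸ A′)       ∎

  supersaturation : ∀ r s u → ¬ HasClique r u → Supersaturated r s u
  supersaturation r zero u _ = ≤-refl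
  supersaturation zero (suc s) u no-K₀ = ⊥-elim (no-K₀ ((λ ()) , (λ ()) , (λ ())))
  supersaturation (suc zero) (suc s) u no-K₁ =
    subst (λ x → x ^ suc s ≤ 1 ^ (suc s * suc s) * indep (suc s) u) (sym no-excess) z≤n
    where
    singleton : ∀ v → T (u v) → HasClique 1 u
    singleton v uv = (λ _ → v) , (λ { zero zero 0≢0 → ⊥-elim (0≢0 refl) }) , (λ _ → uv)
    no-excess : card u ∸ offset 1 (suc s) ≡ 0
    no-excess = trans (cong (_∸ offset 1 (suc s)) (card-empty u (λ v uv → no-K₁ (singleton v uv))))
                      (0∸n≡0 (offset 1 (suc s)))
  supersaturation (suc (suc q)) (suc zero) u _ = begin
    card u * 1                    ≡⟨ *-identityʳ _ ⟩
    card u                        ≤⟨ m≤n*m (card u) (suc (suc q) ^ 1) ⟩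
    suc (suc q) ^ 1 * card u      ≡⟨ cong (suc (suc q) ^ 1 *_) (sum-cong-≗ (λ v → sym (*-identityʳ ⟦ u v ⟧))) ⟩
    suc (suc q) ^ 1 * indep 1 u   ∎
    where open ≤-Reasoning
  supersaturation (suc (suc q)) (suc (suc s)) u no-K =
    dense-or-sparse (λ v uv → supersaturation (suc q) (suc (suc s)) (u ∩ adj G v) (no-K ∘ extend v uv))
                    (λ v → supersaturation (suc (suc q)) (suc s) (u ∩ nonadj v) (no-K ∘ shrink v))
    where
    extend : ∀ v → T (u v) → HasClique (suc q) (u ∩ adj G v) → HasClique (suc (suc q)) u
    extend v uv (f , clique) = v ◃ f , ◃-tupleIn {E = adj G} (Graph.sym G) uv clique
    shrink : ∀ v → HasClique (suc (suc q)) (u ∩ nonadj v) → HasClique (suc (suc q)) u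
    shrink v (f , clique) = f , TupleIn-mono {E = adj G} (∩⊆ˡ u (nonadj v)) clique
    dense-or-sparse : (∀ v → T (u v) → Supersaturated (suc q) (suc (suc s)) (u ∩ adj G v)) →
                      (∀ v → Supersaturated (suc (suc q)) (suc s) (u ∩ nonadj v)) →
                      Supersaturated (suc (suc q)) (suc (suc s)) u
    dense-or-sparse ih-dense ih-sparse =
      case any? (λ v → T? (u v) ×-dec (suc q * (card u ∸ 1) ≤? suc (suc q) * card (u ∩ adj G v))) of λ where
        (yes (v , uv , dense)) → dense-step q s u v uv dense (ih-dense v uv)
        (no no-dense)          → sparse-step (suc (suc q)) s u
          (λ v uv → sparse-vertex (suc q) u v uv (≰⇒> (λ dense → no-dense (v , uv , dense)))) ih-sparse

  -- Common neighbourhoods of independent tuples are small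

  nonadj-sym : ∀ v w → nonadj v w ≡ nonadj w v
  nonadj-sym v w = cong₂ (λ e a → not e ∧ not a) (≟-sym v w) (Graph.sym G v w)

  adj-irrefl : ∀ v → ¬ T (adj G v v)
  adj-irrefl v = subst T (irrefl G v)

  nonadj-irrefl : ∀ v → ¬ T (nonadj v v)
  nonadj-irrefl v with v ≟ v
  ... | yes _  = λ ()
  ... | no v≢v = ⊥-elim (v≢v refl)

  nonadj⇒¬adj : ∀ {v w} → T (nonadj v w) → ¬ Adj G v w
  nonadj⇒¬adj {v} {w} p = T-not⇒¬T (proj₂ (Equivalence.to (T-∧ {not ⌊ v ≟ w ⌋}) p))

  HasClique⇒HasKr : ∀ {r u} → HasClique r u → HasKr r G
  HasClique⇒HasKr (f , pairwise , _) = f , pairwise-injective {E = adj G} adj-irrefl pairwise , pairwise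

  indep-pos⇒tuple : ∀ s u → 0 < indep s u → Σ (Fin s → Fin n) (TupleIn nonadj u)
  indep-pos⇒tuple zero    u _   = (λ ()) , (λ ()) , (λ ())
  indep-pos⇒tuple (suc s) u pos with ∑-pos (λ v → ⟦ u v ⟧ * indep s (u ∩ nonadj v)) pos
  ... | v , pos-v with u v in uv
  ...   | false = ⊥-elim (<-irrefl refl pos-v)
  ...   | true  = let f , tuple = indep-pos⇒tuple s (u ∩ nonadj v) (subst (0 <_) (+-identityʳ _) pos-v)
                  in  v ◃ f , ◃-tupleIn {E = nonadj} {u} nonadj-sym (subst T (sym uv) _) tuple

  commonNbhdᵗ : ∀ {k} → (Fin k → Fin n) → VertexSet n
  commonNbhdᵗ {zero}  y w = true
  commonNbhdᵗ {suc k} y w = adj G (y zero) w ∧ commonNbhdᵗ (y ∘ suc) w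

  commonNbhdᵗ-adj : ∀ {k} (y : Fin k → Fin n) w → T (commonNbhdᵗ y w) → ∀ i → Adj G (y i) w
  commonNbhdᵗ-adj y w p zero    = proj₁ (Equivalence.to T-∧ p)
  commonNbhdᵗ-adj y w p (suc i) = commonNbhdᵗ-adj (y ∘ suc) w (proj₂ (Equivalence.to (T-∧ {adj G (y zero) w}) p)) i

  commonNbhdᵗ-small : ∀ r s t → ¬ HasKr r G → ¬ HasInducedKst s t G →
                      ∀ y → TupleIn nonadj full y → card (commonNbhdᵗ y) ≤ offset r t
  commonNbhdᵗ-small r s t no-Kr no-Kst y (y-indep , _) with card (commonNbhdᵗ y) ≤? offset r t
  ... | yes small = small
  ... | no  large = ⊥-elim (no-Kst (y , z , y-inj , z-inj , disjoint , complete , y-indep′ , z-indep′))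
    where
    c = commonNbhdᵗ y
    excess^t>0 : 0 < (card c ∸ offset r t) ^ t
    excess^t>0 = m^n>0 (card c ∸ offset r t) {{>-nonZero (m<n⇒0<n∸m (≰⇒> large))}} t
    indep>0 : 0 < indep t c
    indep>0 = >-nonZero⁻¹ _ {{m*n≢0⇒n≢0 (r ^ (t * t)) {{>-nonZero K*I>0}}}}
      where
      K*I>0 : 0 < r ^ (t * t) * indep t c
      K*I>0 = ≤-trans excess^t>0 (supersaturation r t c (no-Kr ∘ HasClique⇒HasKr {u = c}))
    z-tuple : Σ (Fin t → Fin n) (TupleIn nonadj c)
    z-tuple = indep-pos⇒tuple t c indep>0
    z = proj₁ z-tuple
    z-indep : Pairwise nonadj z
    z-indep = proj₁ (proj₂ z-tuple)
    y-inj : Injective _≡_ _≡_ y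
    y-inj = pairwise-injective {E = nonadj} nonadj-irrefl y-indep
    z-inj : Injective _≡_ _≡_ z
    z-inj = pairwise-injective {E = nonadj} nonadj-irrefl z-indep
    complete : ∀ i j → Adj G (y i) (z j)
    complete i j = commonNbhdᵗ-adj y (z j) (proj₂ (proj₂ z-tuple) j) i
    disjoint : ∀ i j → y i ≢ z j
    disjoint i j yi≡zj = adj-irrefl (z j) (subst (λ v → Adj G v (z j)) yi≡zj (complete i j))
    y-indep′ : ∀ i i′ → i ≢ i′ → ¬ Adj G (y i) (y i′)
    y-indep′ i i′ i≢i′ = nonadj⇒¬adj (y-indep i i′ i≢i′)
    z-indep′ : ∀ j j′ → j ≢ j′ → ¬ Adj G (z j) (z j′)
    z-indep′ j j′ j≢j′ = nonadj⇒¬adj (z-indep j j′ j≢j′)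

  -- Counting cliques

  IsCliqueSet : VertexSet n → Set
  IsCliqueSet u = ∀ i j → T (u i) → T (u j) → i ≢ j → Adj G i j

  T-isCliqueᵇ : ∀ S → T (isCliqueᵇ G S) ⇔ IsCliqueSet (lookup S)
  T-isCliqueᵇ S = mk⇔
    (λ clique i j Si Sj i≢j →
       to (pair-condition i j) (to (rows i) (to (T-allᵇ-tabulate _ id) clique i) j) (Si , Sj , i≢j))
    (λ clique → from (T-allᵇ-tabulate _ id) (λ i → from (rows i) (λ j →
       from (pair-condition i j) (λ (Si , Sj , i≢j) → clique i j Si Sj i≢j))))
    where
    open Equivalence
    φ : Fin n → Fin n → Bool
    φ i j = not (lookup S i ∧ lookup S j ∧ not ⌊ i ≟ j ⌋) ∨ adj G i j
    rows : ∀ i → T (allᵇ (φ i) (allFin n)) ⇔ (∀ j → T (φ i j))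
    rows i = T-allᵇ-tabulate (φ i) id
    pair-condition : ∀ i j → T (φ i j) ⇔ (T (lookup S i) × T (lookup S j) × i ≢ j → Adj G i j)
    pair-condition i j = mk⇔
      (λ φ (Si , Sj , i≢j) → to T-not-∨ φ (from T-∧ (Si , from T-∧ (Sj , from T-not-≟ i≢j))))
      (λ h → from T-not-∨ (λ t → let (Si , rest) = to T-∧ t ; (Sj , ne) = to T-∧ rest
                                 in h (Si , Sj , to T-not-≟ ne)))

  isCliqueOfᵇ : ℕ → Subset n → Bool
  isCliqueOfᵇ k S = isCliqueᵇ G S ∧ (∣ S ∣ ≡ᵇ k)

  cliques : ℕ → List (Subset n)
  cliques k = filterᵇ (isCliqueOfᵇ k) (allSubsets n)

  commonNbhd : Subset n → VertexSet n
  commonNbhd Q v = Q ⊆ᵇ adj G v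

  clique-minus-vertex : ∀ k Q v → lookup Q v ≡ false → T (isCliqueOfᵇ (suc k) (Q [ v ]≔ inside)) →
                        T (isCliqueOfᵇ k Q) × T (commonNbhd Q v)
  clique-minus-vertex k Q v Qv≡false Q′-clique =
    Equivalence.from T-∧ (from (T-isCliqueᵇ Q) Q-clique , ≡⇒≡ᵇ ∣ Q ∣ k Q-size) ,
    from (T-⊆ᵇ Q (adj G v)) v-joined
    where
    open Equivalence
    Q′ = Q [ v ]≔ inside
    Q′-clique-parts : T (isCliqueᵇ G Q′) × T (∣ Q′ ∣ ≡ᵇ suc k)
    Q′-clique-parts = to T-∧ Q′-clique
    clique′ : IsCliqueSet (lookup Q′)
    clique′ = to (T-isCliqueᵇ Q′) (proj₁ Q′-clique-parts)
    Q′-size : ∣ Q′ ∣ ≡ suc k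
    Q′-size = ≡ᵇ⇒≡ ∣ Q′ ∣ (suc k) (proj₂ Q′-clique-parts)
    Q-size : ∣ Q ∣ ≡ k
    Q-size = suc-injective (trans (sym (∣∣-insert Q v Qv≡false)) Q′-size)
    ≢v : ∀ {j} → T (lookup Q j) → j ≢ v
    ≢v Qj refl = subst T Qv≡false Qj
    Q⊆Q′ : lookup Q ⊆ lookup Q′
    Q⊆Q′ j Qj = subst T (sym (lookup∘update′ (≢v Qj) Q inside)) Qj
    v∈Q′ : T (lookup Q′ v)
    v∈Q′ = subst T (sym (lookup∘update v Q inside)) _
    Q-clique : IsCliqueSet (lookup Q)
    Q-clique i j Qi Qj = clique′ i j (Q⊆Q′ i Qi) (Q⊆Q′ j Qj)
    v-joined : lookup Q ⊆ adj G v
    v-joined j Qj = clique′ v j v∈Q′ (Q⊆Q′ j Qj) (≢v Qj ∘ sym)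

  clique-degree-sum : ∀ k → suc k * cliqueCount G (suc k) ≤ ∑[ Q ∈ cliques k ] card (commonNbhd Q)
  clique-degree-sum k = begin
    suc k * length (cliques (suc k))
      ≡⟨ cong (suc k *_) (length-filterᵇ (isCliqueOfᵇ (suc k)) subsets) ⟩
    suc k * ∑[ S ∈ subsets ] K′ S
      ≡⟨ trans (*-comm (suc k) _) (sym (*-distribʳ-∑ᴸ subsets K′ (suc k))) ⟩
    ∑[ S ∈ subsets ] (K′ S * suc k)
      ≡⟨ ∑ᴸ-cong subsets size-as-sum ⟩
    ∑[ S ∈ subsets ] ∑[ v < n ] (⟦ lookup S v ⟧ * K′ S)
      ≡⟨ ∑ᴸ-∑-comm subsets (λ S v → ⟦ lookup S v ⟧ * K′ S) ⟩
    ∑[ v < n ] ∑[ S ∈ subsets ] (⟦ lookup S v ⟧ * K′ S)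
      ≡⟨ sum-cong-≗ (λ v → ∑-insert v K′) ⟩
    ∑[ v < n ] ∑[ Q ∈ subsets ] (⟦ not (lookup Q v) ⟧ * K′ (Q [ v ]≔ inside))
      ≤⟨ ∑-mono-≤ (λ v → ∑ᴸ-mono-≤ subsets (λ Q → remove-vertex Q v)) ⟩
    ∑[ v < n ] ∑[ Q ∈ subsets ] (K Q * ⟦ commonNbhd Q v ⟧)
      ≡⟨ sym (∑ᴸ-∑-comm subsets (λ Q v → K Q * ⟦ commonNbhd Q v ⟧)) ⟩
    ∑[ Q ∈ subsets ] ∑[ v < n ] (K Q * ⟦ commonNbhd Q v ⟧)
      ≡⟨ ∑ᴸ-cong subsets (λ Q → sym (*-distribˡ-sum (K Q) (λ v → ⟦ commonNbhd Q v ⟧))) ⟩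
    ∑[ Q ∈ subsets ] (K Q * card (commonNbhd Q))
      ≡⟨ sym (∑ᴸ-filterᵇ (isCliqueOfᵇ k) subsets (card ∘ commonNbhd)) ⟩
    ∑[ Q ∈ cliques k ] card (commonNbhd Q)
      ∎
    where
    open ≤-Reasoning
    subsets = allSubsets n
    K K′ : Subset n → ℕ
    K Q = ⟦ isCliqueOfᵇ k Q ⟧
    K′ S = ⟦ isCliqueOfᵇ (suc k) S ⟧
    size-as-sum : ∀ S → K′ S * suc k ≡ ∑[ v < n ] (⟦ lookup S v ⟧ * K′ S)
    size-as-sum S = trans (weight (isCliqueOfᵇ (suc k) S) refl)
                          (trans (cong (_* K′ S) (∣∣≡card S)) (*-distribʳ-sum (K′ S) (λ v → ⟦ lookup S v ⟧)))
      where
      weight : ∀ b → b ≡ isCliqueOfᵇ (suc k) S → ⟦ b ⟧ * suc k ≡ ∣ S ∣ * ⟦ b ⟧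
      weight false _ = sym (*-zeroʳ ∣ S ∣)
      weight true  b≡K = trans (cong (1 *_) (sym (≡ᵇ⇒≡ ∣ S ∣ (suc k) size))) (*-comm 1 ∣ S ∣)
        where size = proj₂ (Equivalence.to (T-∧ {isCliqueᵇ G S}) (subst T b≡K _))
    remove-vertex : ∀ Q v → ⟦ not (lookup Q v) ⟧ * K′ (Q [ v ]≔ inside) ≤ K Q * ⟦ commonNbhd Q v ⟧
    remove-vertex Q v with lookup Q v in Qv
    ... | true  = z≤n
    ... | false = subst₂ _≤_ (sym (*-identityˡ _)) (⟦⟧-∧ (isCliqueOfᵇ k Q) (commonNbhd Q v))
                    (⟦⟧-mono {isCliqueOfᵇ (suc k) (Q [ v ]≔ inside)} (Equivalence.from T-∧ ∘ clique-minus-vertex k Q v Qv))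

  cliques-within : ∀ k (c : VertexSet n) → ∑[ Q ∈ cliques k ] ⟦ Q ⊆ᵇ c ⟧ ≤ card c ^ k
  cliques-within k c = begin
    ∑[ Q ∈ cliques k ] ⟦ Q ⊆ᵇ c ⟧                              ≡⟨ ∑ᴸ-filterᵇ (isCliqueOfᵇ k) (allSubsets n) _ ⟩
    ∑[ Q ∈ allSubsets n ] (⟦ isCliqueOfᵇ k Q ⟧ * ⟦ Q ⊆ᵇ c ⟧)   ≤⟨ ∑ᴸ-mono-≤ (allSubsets n) weaken ⟩
    ∑[ Q ∈ allSubsets n ] ⟦ Q ⊆ᵇ c ∧ (∣ Q ∣ ≡ᵇ k) ⟧            ≤⟨ subsets-within n c k ⟩
    card c ^ k                                                 ∎
    where
    open ≤-Reasoning
    weaken : ∀ Q → ⟦ isCliqueOfᵇ k Q ⟧ * ⟦ Q ⊆ᵇ c ⟧ ≤ ⟦ Q ⊆ᵇ c ∧ (∣ Q ∣ ≡ᵇ k) ⟧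
    weaken Q = subst (_≤ _) (⟦⟧-∧ (isCliqueOfᵇ k Q) (Q ⊆ᵇ c)) (⟦⟧-mono λ p →
      let (K , Q⊆c) = to T-∧ p in from T-∧ (Q⊆c , proj₂ (to (T-∧ {isCliqueᵇ G Q}) K)))
      where open Equivalence

  cliqueCount≤n^k : ∀ k → cliqueCount G k ≤ n ^ k
  cliqueCount≤n^k k = begin
    length (cliques k)                  ≡⟨ sym (*-identityʳ _) ⟩
    length (cliques k) * 1              ≡⟨ sym (∑ᴸ-const (cliques k) 1) ⟩
    ∑[ Q ∈ cliques k ] 1                ≡⟨ ∑ᴸ-cong (cliques k) (λ Q → sym (⟦⟧-true (⊆ᵇ-full Q))) ⟩
    ∑[ Q ∈ cliques k ] ⟦ Q ⊆ᵇ full ⟧    ≤⟨ cliques-within k (full {n}) ⟩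
    card (full {n}) ^ k                   ≡⟨ cong (_^ k) (card-full {n}) ⟩
    n ^ k                               ∎
    where open ≤-Reasoning

  -- Counts the pairs (Q, y) of a k-clique Q inside c and an independent j-tuple y in u ∩ N(Q),
  -- summing over y first.
  indep-commonNbhd-bound : ∀ k R j (u c : VertexSet n) →
    (∀ (y : Fin j → Fin n) → TupleIn nonadj u y → card (c ∩ commonNbhdᵗ y) ≤ R) →
    ∑[ Q ∈ cliques k ] (⟦ Q ⊆ᵇ c ⟧ * indep j (u ∩ commonNbhd Q)) ≤ n ^ j * R ^ k
  indep-commonNbhd-bound k R zero u c small = begin
    ∑[ Q ∈ cliques k ] (⟦ Q ⊆ᵇ c ⟧ * 1) ≡⟨ ∑ᴸ-cong (cliques k) (λ Q → *-identityʳ _) ⟩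
    ∑[ Q ∈ cliques k ] ⟦ Q ⊆ᵇ c ⟧       ≤⟨ cliques-within k c ⟩
    card c ^ k                          ≤⟨ ^-monoˡ-≤ k (≤-trans (card-mono c⊆c∩full) (small (λ ()) ((λ ()) , (λ ())))) ⟩
    R ^ k                               ≡⟨ sym (*-identityˡ _) ⟩
    1 * R ^ k                           ∎
    where
    open ≤-Reasoning
    c⊆c∩full : c ⊆ c ∩ full
    c⊆c∩full w cw = Equivalence.from T-∧ (cw , _)
  indep-commonNbhd-bound k R (suc j) u c small = begin
    ∑[ Q ∈ cliques k ] (⟦ Q ⊆ᵇ c ⟧ * ∑[ v < n ] I₀ Q v)
      ≡⟨ ∑ᴸ-cong (cliques k) (λ Q → *-distribˡ-sum ⟦ Q ⊆ᵇ c ⟧ (I₀ Q)) ⟩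
    ∑[ Q ∈ cliques k ] ∑[ v < n ] (⟦ Q ⊆ᵇ c ⟧ * I₀ Q v)
      ≤⟨ ∑ᴸ-mono-≤ (cliques k) (λ Q → ∑-mono-≤ (move-vertex Q)) ⟩
    ∑[ Q ∈ cliques k ] ∑[ v < n ] (⟦ u v ⟧ * I Q v)
      ≡⟨ ∑ᴸ-∑-comm (cliques k) (λ Q v → ⟦ u v ⟧ * I Q v) ⟩
    ∑[ v < n ] ∑[ Q ∈ cliques k ] (⟦ u v ⟧ * I Q v)
      ≡⟨ sum-cong-≗ (λ v → *-distribˡ-∑ᴸ (cliques k) (λ Q → I Q v) ⟦ u v ⟧) ⟩
    ∑[ v < n ] (⟦ u v ⟧ * ∑[ Q ∈ cliques k ] I Q v)
      ≤⟨ ∑-≤-const per-vertex ⟩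
    n * (n ^ j * R ^ k)
      ≡⟨ sym (*-assoc n (n ^ j) (R ^ k)) ⟩
    n ^ suc j * R ^ k
      ∎
    where
    open ≤-Reasoning
    I₀ I : Subset n → Fin n → ℕ
    I₀ Q v = ⟦ (u ∩ commonNbhd Q) v ⟧ * indep j ((u ∩ commonNbhd Q) ∩ nonadj v)
    I Q v = ⟦ Q ⊆ᵇ c ∩ adj G v ⟧ * indep j ((u ∩ nonadj v) ∩ commonNbhd Q)
    ⟦⟧-*-⟦⟧ : ∀ a b x → ⟦ a ⟧ * (⟦ b ⟧ * x) ≡ ⟦ a ∧ b ⟧ * x
    ⟦⟧-*-⟦⟧ a b x = trans (sym (*-assoc ⟦ a ⟧ ⟦ b ⟧ x)) (cong (_* x) (sym (⟦⟧-∧ a b)))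
    move-vertex : ∀ Q v → ⟦ Q ⊆ᵇ c ⟧ * I₀ Q v ≤ ⟦ u v ⟧ * I Q v
    move-vertex Q v = subst₂ _≤_ (sym (⟦⟧-*-⟦⟧ (Q ⊆ᵇ c) _ _)) (sym (⟦⟧-*-⟦⟧ (u v) _ _))
      (*-mono-≤ (⟦⟧-mono bools) (indep-mono j reorder))
      where
      open Equivalence
      bools : T (Q ⊆ᵇ c ∧ (u v ∧ commonNbhd Q v)) → T (u v ∧ Q ⊆ᵇ c ∩ adj G v)
      bools p = let (Q⊆c , uv , v-joined) = map₂ (to (T-∧ {u v})) (to (T-∧ {Q ⊆ᵇ c}) p) in
        from T-∧ (uv , from (T-⊆ᵇ Q (c ∩ adj G v)) (λ w Qw →
          from T-∧ (to (T-⊆ᵇ Q c) Q⊆c w Qw , to (T-⊆ᵇ Q (adj G v)) v-joined w Qw)))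
      reorder : (u ∩ commonNbhd Q) ∩ nonadj v ⊆ (u ∩ nonadj v) ∩ commonNbhd Q
      reorder w p = let ((uw , Qw) , vw) = map₁ (to (T-∧ {u w})) (to (T-∧ {u w ∧ commonNbhd Q w}) p)
                    in  from T-∧ (from T-∧ (uw , vw) , Qw)
    per-vertex : ∀ v → ⟦ u v ⟧ * ∑[ Q ∈ cliques k ] I Q v ≤ n ^ j * R ^ k
    per-vertex v with u v in uv
    ... | false = z≤n
    ... | true  = ≤-trans (≤-reflexive (+-identityʳ _))
      (indep-commonNbhd-bound k R j (u ∩ nonadj v) (c ∩ adj G v) (λ y y-indep →
        ≤-trans (card-mono (λ w → subst T (∧-assoc (c w) (adj G v w) (commonNbhdᵗ y w))))
                (small (v ◃ y) (◃-tupleIn {E = nonadj} {u} nonadj-sym (subst T (sym uv) _) y-indep))))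

  clique-bound : ∀ r s t k → ¬ HasKr r G → ¬ HasInducedKst (suc s) t G →
    (suc k * cliqueCount G (suc k) ∸ cliqueCount G k * offset r (suc s)) ^ suc s
      ≤ cliqueCount G k ^ s * (r ^ (suc s * suc s) * (n ^ suc s * offset r t ^ k))
  clique-bound r s t k no-Kr no-Kst = begin
    (suc k * cliqueCount G (suc k) ∸ N * A) ^ suc s      ≤⟨ ^-monoˡ-≤ (suc s) excess ⟩
    S ^ suc s                                           ≤⟨ power-mean (cliques k) (λ Q → D Q ∸ A) s ⟩
    N ^ s * ∑[ Q ∈ cliques k ] ((D Q ∸ A) ^ suc s)      ≤⟨ *-monoʳ-≤ (N ^ s) supersaturated ⟩
    N ^ s * (K * ∑[ Q ∈ cliques k ] I Q)                ≤⟨ *-monoʳ-≤ (N ^ s) (*-monoʳ-≤ K few-indep) ⟩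
    N ^ s * (K * (n ^ suc s * offset r t ^ k))          ∎
    where
    open ≤-Reasoning
    N = cliqueCount G k
    A = offset r (suc s)
    K = r ^ (suc s * suc s)
    D : Subset n → ℕ
    D Q = card (commonNbhd Q)
    I : Subset n → ℕ
    I Q = indep (suc s) (commonNbhd Q)
    S = ∑[ Q ∈ cliques k ] (D Q ∸ A)
    excess : suc k * cliqueCount G (suc k) ∸ N * A ≤ S
    excess = m≤n+o⇒m∸n≤o _ (N * A) (begin
      suc k * cliqueCount G (suc k)                       ≤⟨ clique-degree-sum k ⟩
      ∑[ Q ∈ cliques k ] D Q                              ≤⟨ ∑ᴸ-mono-≤ (cliques k) (λ Q → m≤n+m∸n (D Q) A) ⟩
      ∑[ Q ∈ cliques k ] (A + (D Q ∸ A))                  ≡⟨ ∑ᴸ-distrib-+ (cliques k) (λ _ → A) (λ Q → D Q ∸ A) ⟩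
      ∑[ Q ∈ cliques k ] A + S                            ≡⟨ cong (_+ S) (∑ᴸ-const (cliques k) A) ⟩
      N * A + S                                           ∎)
    supersaturated : ∑[ Q ∈ cliques k ] ((D Q ∸ A) ^ suc s) ≤ K * ∑[ Q ∈ cliques k ] I Q
    supersaturated = ≤-trans (∑ᴸ-mono-≤ (cliques k) (λ Q → supersaturation r (suc s) (commonNbhd Q) (no-K Q)))
                             (≤-reflexive (*-distribˡ-∑ᴸ (cliques k) I K))
      where
      no-K : ∀ Q → ¬ HasClique r (commonNbhd Q)
      no-K Q = no-Kr ∘ HasClique⇒HasKr {u = commonNbhd Q}
    few-indep : ∑[ Q ∈ cliques k ] I Q ≤ n ^ suc s * offset r t ^ k
    few-indep = ≤-trans (≤-reflexive (∑ᴸ-cong (cliques k) (λ Q → sym (weight-one Q))))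
      (indep-commonNbhd-bound k (offset r t) (suc s) full full (commonNbhdᵗ-small r (suc s) t no-Kr no-Kst))
      where
      weight-one : ∀ Q → ⟦ Q ⊆ᵇ full ⟧ * I Q ≡ I Q
      weight-one Q = trans (cong (_* I Q) (⟦⟧-true (⊆ᵇ-full Q))) (+-identityʳ (I Q))

theorem2 : (r s t m n : ℕ) → 1 ≤ r → 1 ≤ s → 1 ≤ t → 1 ≤ m →
    (G : Graph n) → ¬ HasKr r G → ¬ HasInducedKst s t G →
    (m * cliqueCount G m ∸ (r + s) ^ s * n ^ (m ∸ 1)) ^ s
      ≤ (2 * (r + s) ^ s) ^ s * (t + r) ^ (t * m) * n ^ (s * m ∸ m + 1)
theorem2 r (suc s) (suc t) (suc k) n _ (s≤s _) (s≤s _) (s≤s _) G no-Kr no-Kst = begin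
  (suc k * cliqueCount G (suc k) ∸ (r + suc s) ^ suc s * n ^ k) ^ suc s
    ≤⟨ ^-monoˡ-≤ (suc s) (∸-monoʳ-≤ _ subtracted≤) ⟩
  (suc k * cliqueCount G (suc k) ∸ N * offset r (suc s)) ^ suc s
    ≤⟨ clique-bound G r s (suc t) k no-Kr no-Kst ⟩
  N ^ s * (r ^ (suc s * suc s) * (n ^ suc s * offset r (suc t) ^ k))
    ≤⟨ *-mono-≤ N^s≤ (*-mono-≤ (r^[e*e]≤[2*[r+e]^e]^e r e) (*-monoʳ-≤ (n ^ suc s) (offset^k≤ r t k))) ⟩
  n ^ (k * s) * (C₁ * (n ^ suc s * C₂))
    ≡⟨ solve 4 (λ a c₁ b c₂ → a :* (c₁ :* (b :* c₂)) := c₁ :* c₂ :* (a :* b))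
               refl (n ^ (k * s)) C₁ (n ^ suc s) C₂ ⟩
  C₁ * C₂ * (n ^ (k * s) * n ^ suc s)
    ≡⟨ cong (C₁ * C₂ *_) (trans (sym (^-distribˡ-+-* n (k * s) (suc s))) (cong (n ^_) exponent)) ⟩
  C₁ * C₂ * n ^ (suc s * suc k ∸ suc k + 1)
    ∎
  where
  open ≤-Reasoning
  N = cliqueCount G k
  e = suc s
  C₁ = (2 * (r + e) ^ e) ^ e
  C₂ = (suc t + r) ^ (suc t * suc k)
  subtracted≤ : N * offset r e ≤ (r + e) ^ e * n ^ k
  subtracted≤ = ≤-trans (*-mono-≤ (cliqueCount≤n^k G k) (≤-trans (offset≤^ r e) (^-monoˡ-≤ e (m≤m+n r e))))
                        (≤-reflexive (*-comm (n ^ k) _))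
  N^s≤ : N ^ s ≤ n ^ (k * s)
  N^s≤ = ≤-trans (^-monoˡ-≤ s (cliqueCount≤n^k G k)) (≤-reflexive (^-*-assoc n k s))
  exponent : k * s + suc s ≡ suc s * suc k ∸ suc k + 1
  exponent = sym (trans (cong (_+ 1) (m+n∸m≡n (suc k) (s * suc k)))
                        (solve 2 (λ k s → s :* (con 1 :+ k) :+ con 1 := k :* s :+ (con 1 :+ s)) refl k s))
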